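{- Let $f,h\ge1$ be integers. The function $w:\mathbb N\to\mathbb N$ defined by $$w(k)=\frac{k\,\varphi(\mathrm{lcm}(k,f))}{(k,h)\,\varphi(f)}$$ is multiplicative. Furthermore, for a prime $p$: (i) if $p\nmid h$ and $p\nmid f$ then $w(p)=p(p-1)$; (ii) if $p\nmid h$ and $p\mid f$ then $w(p)=p$; (iii) if $p\mid h$ and $p\nmid f$ then $w(p)=p-1$; (iv) if $p\mid h$ and $p\mid f$ then $w(p)=1$; (v) if $h$ is odd then $w(2)=2$.
   Context: $\varphi$ is Euler's totient and $(k,h)$ is the gcd. -}

module Defs where

open import Data.Nat using (ℕ; suc; _*_; _≟_)
open import Data.Nat.GCD using (gcd)
open import Data.Nat.LCM using (lcm)
open import Data.List using (List; length; filter; map; upTo)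

φ : ℕ → ℕ
φ n = length (filter (λ k → gcd k n ≟ 1) (map suc (upTo n)))

wNum : ℕ → ℕ → ℕ
wNum f k = k * φ (lcm k f)

wDen : ℕ → ℕ → ℕ → ℕ
wDen f h k = gcd k h * φ f

-- Multiplying n by a prime p multiplies φ n by p when p ∣ n and by p − 1 otherwise
-- (count the residues coprime to n in p blocks of length n, and discard the multiples
-- of p when p ∤ n). Peeling the primes of a off one at a time shows φ f ∣ φ (f a), and,
-- since a prime of a never divides a coprime b, that the factors picked up are the same
-- over f and over f b: φ (f a b) φ f = φ (f a) φ (f b). As lcm (k, f) = f · k/(k, f) and
-- both k ↦ k/(k, f) and k ↦ (k, h) are multiplicative, w is an integer-valued
-- multiplicative function. At a prime, lcm (p, f) is f or p f and (p, h) is 1 or p.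

module Submission where

open import Data.Bool.Base using (if_then_else_)
open import Data.List.Base using (_∷_; [_]; _++_; length; filter; map; upTo)
open import Data.List.Properties using (upTo-∷ʳ; map-++; filter-++; length-++)
open import Data.List.Relation.Unary.All using (All; []; _∷_)
open import Data.Nat.Base
open import Data.Nat.Properties
open import Data.Nat.Divisibility
open import Data.Nat.GCD
open import Data.Nat.LCM using (lcm; lcm-least; n∣lcm[m,n]; gcd*lcm)
open import Data.Nat.Coprimality as Coprimality
  using (Coprime; coprime?; coprime-divisor; coprime-+; coprime⇒gcd≡1; gcd≡1⇒coprime; 1-coprimeTo)
open import Data.Nat.Primality
open import Data.Nat.Primality.Factorisation using (PrimeFactorisation; factorise)
open import Data.Nat.ListAction using (product)
open import Algebra.Properties.CommutativeSemigroup +-commutativeSemigroup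
  using () renaming (interchange to +-interchange)
open import Algebra.Properties.CommutativeSemigroup *-commutativeSemigroup
  using (x∙yz≈y∙xz; xy∙z≈y∙zx) renaming (interchange to *-interchange)
open import Data.Product.Base using (Σ; _×_; _,_; proj₁)
open import Data.Sum.Base using (inj₁; inj₂; [_,_]′)
open import Function.Base using (_∘_; id)
open import Function.Bundles using (_⇔_; mk⇔; Equivalence)
open import Level using (Level)
open import Relation.Binary.PropositionalEquality hiding ([_])
open import Relation.Nullary.Decidable using (Dec; yes; no; does; does-⇔; dec-true; dec-false; _×-dec_; ¬?)
open import Relation.Nullary.Negation using (¬_; contradiction)
open import Relation.Unary using (Pred; Decidable; _∩_)
open import Relation.Unary.Properties using (_∩?_; ∁?)

open import Defs

open ≡-Reasoning

private
  variable
    a b ℓ ℓ′ : Level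
    A : Set a
    B : Set b
    P : Pred ℕ ℓ
    Q : Pred ℕ ℓ′
    d m n o p : ℕ

𝟙 : Dec A → ℕ
𝟙 a? = if does a? then 1 else 0

𝟙-yes : (a? : Dec A) → A → 𝟙 a? ≡ 1
𝟙-yes a? x = cong (if_then 1 else 0) (dec-true a? x)

𝟙-no : (a? : Dec A) → ¬ A → 𝟙 a? ≡ 0
𝟙-no a? ¬x = cong (if_then 1 else 0) (dec-false a? ¬x)

𝟙-cong : (a? : Dec A) (b? : Dec B) → A ⇔ B → 𝟙 a? ≡ 𝟙 b?
𝟙-cong a? b? A⇔B = cong (if_then 1 else 0) (does-⇔ A⇔B a? b?)

𝟙-split : (a? : Dec A) (b? : Dec B) → 𝟙 a? ≡ 𝟙 (a? ×-dec b?) + 𝟙 (a? ×-dec ¬? b?)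
𝟙-split (yes _) (yes _) = refl
𝟙-split (yes _) (no _)  = refl
𝟙-split (no _)  _       = refl

count : Decidable P → ℕ → ℕ
count P? zero    = 0
count P? (suc n) = count P? n + 𝟙 (P? (suc n))

length-filter-[x] : (P? : Decidable P) (x : ℕ) → length (filter P? [ x ]) ≡ 𝟙 (P? x)
length-filter-[x] P? x with P? x
... | yes _ = refl
... | no _  = refl

length-filter-upTo : (P? : Decidable P) (n : ℕ) →
                     length (filter P? (map suc (upTo n))) ≡ count P? n
length-filter-upTo P? zero    = refl
length-filter-upTo P? (suc n) = begin
  length (filter P? (map suc (upTo (suc n))))
    ≡⟨ cong (λ xs → length (filter P? (map suc xs))) (upTo-∷ʳ n) ⟨
  length (filter P? (map suc (upTo n ++ [ n ])))
    ≡⟨ cong (λ xs → length (filter P? xs)) (map-++ suc (upTo n) [ n ]) ⟩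
  length (filter P? (map suc (upTo n) ++ [ suc n ]))
    ≡⟨ cong length (filter-++ P? (map suc (upTo n)) [ suc n ]) ⟩
  length (filter P? (map suc (upTo n)) ++ filter P? [ suc n ])
    ≡⟨ length-++ (filter P? (map suc (upTo n))) ⟩
  length (filter P? (map suc (upTo n))) + length (filter P? [ suc n ])
    ≡⟨ cong₂ _+_ (length-filter-upTo P? n) (length-filter-[x] P? (suc n)) ⟩
  count P? (suc n) ∎

count-cong : (P? : Decidable P) (Q? : Decidable Q) → (∀ x → P x ⇔ Q x) →
             ∀ n → count P? n ≡ count Q? n
count-cong P? Q? P⇔Q zero    = refl
count-cong P? Q? P⇔Q (suc n) =
  cong₂ _+_ (count-cong P? Q? P⇔Q n) (𝟙-cong (P? (suc n)) (Q? (suc n)) (P⇔Q (suc n)))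

count-+ : (P? : Decidable P) → ∀ m n → count P? (m + n) ≡ count P? m + count (λ x → P? (m + x)) n
count-+ P? m zero    = trans (cong (count P?) (+-identityʳ m)) (sym (+-identityʳ _))
count-+ P? m (suc n) = begin
  count P? (m + suc n)                                        ≡⟨ cong (count P?) (+-suc m n) ⟩
  count P? (m + n) + 𝟙 (P? (suc (m + n)))
    ≡⟨ cong₂ _+_ (count-+ P? m n) (cong (λ x → 𝟙 (P? x)) (sym (+-suc m n))) ⟩
  count P? m + count (λ x → P? (m + x)) n + 𝟙 (P? (m + suc n)) ≡⟨ +-assoc (count P? m) _ _ ⟩
  count P? m + count (λ x → P? (m + x)) (suc n)               ∎

count-periodic : (P? : Decidable P) → ∀ m → (∀ x → P (m + x) ⇔ P x) →
                 ∀ d → count P? (d * m) ≡ d * count P? m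
count-periodic P? m period zero    = refl
count-periodic P? m period (suc d) = begin
  count P? (m + d * m)                           ≡⟨ count-+ P? m (d * m) ⟩
  count P? m + count (λ x → P? (m + x)) (d * m)
    ≡⟨ cong (count P? m +_) (count-cong _ P? period (d * m)) ⟩
  count P? m + count P? (d * m)
    ≡⟨ cong (count P? m +_) (count-periodic P? m period d) ⟩
  count P? m + d * count P? m ∎

count-split : (P? : Decidable P) (Q? : Decidable Q) →
              ∀ n → count P? n ≡ count (P? ∩? Q?) n + count (P? ∩? ∁? Q?) n
count-split P? Q? zero    = refl
count-split P? Q? (suc n) = begin
  count P? n + 𝟙 (P? (suc n))
    ≡⟨ cong₂ _+_ (count-split P? Q? n) (𝟙-split (P? (suc n)) (Q? (suc n))) ⟩
  (count (P? ∩? Q?) n + count (P? ∩? ∁? Q?) n)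
    + (𝟙 ((P? ∩? Q?) (suc n)) + 𝟙 ((P? ∩? ∁? Q?) (suc n)))
    ≡⟨ +-interchange (count (P? ∩? Q?) n) _ _ _ ⟩
  count (P? ∩? Q?) (suc n) + count (P? ∩? ∁? Q?) (suc n) ∎

count-none : (P? : Decidable P) → ∀ n → (∀ {x} → x < n → ¬ P (suc x)) → count P? n ≡ 0
count-none P? zero    ¬P = refl
count-none P? (suc n) ¬P =
  cong₂ _+_ (count-none P? n (λ x<n → ¬P (m<n⇒m<1+n x<n))) (𝟙-no (P? (suc n)) (¬P ≤-refl))

count-multiples : (P? : Decidable P) → ∀ m .{{_ : NonZero m}} n →
                  count (P? ∩? (m ∣?_)) (m * n) ≡ count (λ y → P? (m * y)) n
count-multiples P? m         zero    = cong (count _) (*-zeroʳ m)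
count-multiples {P = P} P? m@(suc k) (suc n) = begin
  count Q? (m * suc n) ≡⟨ cong (count Q?) m*[1+n]≡m*n+m ⟩
  count Q? (m * n + m) ≡⟨ count-+ Q? (m * n) m ⟩
  count Q? (m * n) + (count (λ x → Q? (m * n + x)) k + 𝟙 (Q? (m * n + m)))
    ≡⟨ cong₂ _+_ (count-multiples P? m n) (cong₂ _+_ (count-none _ k m∤) last) ⟩
  count (λ y → P? (m * y)) (suc n) ∎
  where
  Q? : Decidable (P ∩ (m ∣_))
  Q? = P? ∩? (m ∣?_)
  m*[1+n]≡m*n+m : m * suc n ≡ m * n + m
  m*[1+n]≡m*n+m = trans (*-suc m n) (+-comm m (m * n))
  m∤ : ∀ {x} → x < k → ¬ (P (m * n + suc x) × m ∣ m * n + suc x)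
  m∤ x<k (_ , m∣) = <⇒≱ (s≤s x<k) (∣⇒≤ (∣m+n∣m⇒∣n m∣ (m∣m*n n)))
  last : 𝟙 (Q? (m * n + m)) ≡ 𝟙 (P? (m * suc n))
  last = 𝟙-cong (Q? (m * n + m)) (P? (m * suc n)) (mk⇔
    (λ (Px , _) → subst P (sym m*[1+n]≡m*n+m) Px)
    (λ Px → subst P m*[1+n]≡m*n+m Px , ∣m∣n⇒∣m+n (m∣m*n n) ∣-refl))

coprime-∣ˡ : Coprime m n → d ∣ m → Coprime d n
coprime-∣ˡ c d∣m (e∣d , e∣n) = c (∣-trans e∣d d∣m , e∣n)

coprime-∣ʳ : Coprime m n → d ∣ n → Coprime m d
coprime-∣ʳ c d∣n (e∣m , e∣d) = c (e∣m , ∣-trans e∣d d∣n)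

coprime-*ʳ : Coprime m n → Coprime m o → Coprime m (n * o)
coprime-*ʳ c₁ c₂ (e∣m , e∣no) = c₂ (e∣m , coprime-divisor (coprime-∣ˡ c₁ e∣m) e∣no)

coprime-*ˡ : Coprime m o → Coprime n o → Coprime (m * n) o
coprime-*ˡ c₁ c₂ = Coprimality.sym (coprime-*ʳ (Coprimality.sym c₁) (Coprimality.sym c₂))

prime∤⇒coprime : Prime p → ¬ p ∣ n → Coprime p n
prime∤⇒coprime pp p∤n (d∣p , d∣n) with prime⇒irreducible pp d∣p
... | inj₁ d≡1 = d≡1
... | inj₂ refl = contradiction d∣n p∤n

coprime⇒prime∤ : Prime p → Coprime p n → ¬ p ∣ n
coprime⇒prime∤ pp c p∣n = nonTrivial⇒≢1 {{prime⇒nonTrivial pp}} (c (∣-refl , p∣n))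

coprime[n+x,n]⇔coprime[x,n] : ∀ n x → Coprime (n + x) n ⇔ Coprime x n
coprime[n+x,n]⇔coprime[x,n] n x = mk⇔ to coprime-+
  where
  to : Coprime (n + x) n → Coprime x n
  to c (e∣x , e∣n) = c (∣m∣n⇒∣m+n e∣n e∣x , e∣n)

coprime[x,p*n]⇔coprime[x,n]∧p∤x : Prime p → ∀ n x →
                                  Coprime x (p * n) ⇔ (Coprime x n × ¬ p ∣ x)
coprime[x,p*n]⇔coprime[x,n]∧p∤x {p} pp n x = mk⇔ to from
  where
  to : Coprime x (p * n) → Coprime x n × ¬ p ∣ x
  to c = coprime-∣ʳ c (n∣m*n p) , coprime⇒prime∤ pp (Coprimality.sym (coprime-∣ʳ c (m∣m*n n)))
  from : Coprime x n × ¬ p ∣ x → Coprime x (p * n)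
  from (c , p∤x) = coprime-*ʳ (Coprimality.sym (prime∤⇒coprime pp p∤x)) c

coprime[x,p*n]⇔coprime[x,n] : Prime p → p ∣ n → ∀ x → Coprime x (p * n) ⇔ Coprime x n
coprime[x,p*n]⇔coprime[x,n] {p} {n} pp p∣n x = mk⇔ (proj₁ ∘ to) from′
  where
  open Equivalence (coprime[x,p*n]⇔coprime[x,n]∧p∤x pp n x)
  from′ : Coprime x n → Coprime x (p * n)
  from′ c = from (c , coprime⇒prime∤ pp (coprime-∣ˡ (Coprimality.sym c) p∣n))

coprime[p*y,n]⇔coprime[y,n] : Prime p → ¬ p ∣ n → ∀ y → Coprime (p * y) n ⇔ Coprime y n
coprime[p*y,n]⇔coprime[y,n] {p} {n} pp p∤n y = mk⇔ to (coprime-*ˡ (prime∤⇒coprime pp p∤n))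
  where
  to : Coprime (p * y) n → Coprime y n
  to c = coprime-∣ˡ c (n∣m*n p)

coprimeTo? : ∀ n → Decidable (λ x → Coprime x n)
coprimeTo? n x = coprime? x n

φ≡count : ∀ n → φ n ≡ count (coprimeTo? n) n
φ≡count n = trans (length-filter-upTo (λ x → gcd x n ≟ 1) n)
                  (count-cong _ (coprimeTo? n) (λ x → mk⇔ gcd≡1⇒coprime coprime⇒gcd≡1) n)

count-coprimeTo : ∀ n d → count (coprimeTo? n) (d * n) ≡ d * φ n
count-coprimeTo n d = begin
  count (coprimeTo? n) (d * n) ≡⟨ count-periodic (coprimeTo? n) n (coprime[n+x,n]⇔coprime[x,n] n) d ⟩
  d * count (coprimeTo? n) n   ≡⟨ cong (d *_) (φ≡count n) ⟨
  d * φ n                      ∎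

φ[p*n]≡p*φ[n] : Prime p → p ∣ n → φ (p * n) ≡ p * φ n
φ[p*n]≡p*φ[n] {p} {n} pp p∣n = begin
  φ (p * n)                          ≡⟨ φ≡count (p * n) ⟩
  count (coprimeTo? (p * n)) (p * n) ≡⟨ count-cong _ _ (coprime[x,p*n]⇔coprime[x,n] pp p∣n) (p * n) ⟩
  count (coprimeTo? n) (p * n)       ≡⟨ count-coprimeTo n p ⟩
  p * φ n                            ∎

φ[p*n]+φ[n]≡p*φ[n] : Prime p → ¬ p ∣ n → φ (p * n) + φ n ≡ p * φ n
φ[p*n]+φ[n]≡p*φ[n] {p} {n} pp p∤n = begin
  φ (p * n) + φ n
    ≡⟨ +-comm (φ (p * n)) (φ n) ⟩
  φ n + φ (p * n)
    ≡⟨ cong₂ _+_ multiples non-multiples ⟨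
  count (coprimeTo? n ∩? (p ∣?_)) (p * n) + count (coprimeTo? n ∩? ∁? (p ∣?_)) (p * n)
    ≡⟨ count-split (coprimeTo? n) (p ∣?_) (p * n) ⟨
  count (coprimeTo? n) (p * n)
    ≡⟨ count-coprimeTo n p ⟩
  p * φ n ∎
  where
  multiples : count (coprimeTo? n ∩? (p ∣?_)) (p * n) ≡ φ n
  multiples = begin
    count (coprimeTo? n ∩? (p ∣?_)) (p * n) ≡⟨ count-multiples (coprimeTo? n) p {{prime⇒nonZero pp}} n ⟩
    count (λ y → coprimeTo? n (p * y)) n    ≡⟨ count-cong _ _ (coprime[p*y,n]⇔coprime[y,n] pp p∤n) n ⟩
    count (coprimeTo? n) n                  ≡⟨ φ≡count n ⟨
    φ n                                     ∎
  non-multiples : count (coprimeTo? n ∩? ∁? (p ∣?_)) (p * n) ≡ φ (p * n)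
  non-multiples = begin
    count (coprimeTo? n ∩? ∁? (p ∣?_)) (p * n)
      ≡⟨ count-cong _ _ (coprime[x,p*n]⇔coprime[x,n]∧p∤x pp n) (p * n) ⟨
    count (coprimeTo? (p * n)) (p * n)
      ≡⟨ φ≡count (p * n) ⟨
    φ (p * n) ∎

φ[p*n]≡[p∸1]*φ[n] : Prime p → ¬ p ∣ n → φ (p * n) ≡ (p ∸ 1) * φ n
φ[p*n]≡[p∸1]*φ[n] {p} {n} pp p∤n = begin
  φ (p * n)               ≡⟨ m+n∸n≡m (φ (p * n)) (φ n) ⟨
  φ (p * n) + φ n ∸ φ n   ≡⟨ cong (_∸ φ n) (φ[p*n]+φ[n]≡p*φ[n] pp p∤n) ⟩
  p * φ n ∸ φ n           ≡⟨ cong (p * φ n ∸_) (*-identityˡ (φ n)) ⟨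
  p * φ n ∸ 1 * φ n       ≡⟨ *-distribʳ-∸ (φ n) p 1 ⟨
  (p ∸ 1) * φ n           ∎

φ[n]≢0 : ∀ n .{{_ : NonZero n}} → NonZero (φ n)
φ[n]≢0 n@(suc k) = >-nonZero (subst (0 <_) (sym φ[n]≡1+c) z<s)
  where
  c : ℕ
  c = count (λ x → coprimeTo? n (1 + x)) k
  φ[n]≡1+c : φ n ≡ 1 + c
  φ[n]≡1+c = begin
    φ n                          ≡⟨ φ≡count n ⟩
    count (coprimeTo? n) (1 + k) ≡⟨ count-+ (coprimeTo? n) 1 k ⟩
    𝟙 (coprime? 1 n) + c         ≡⟨ cong (_+ c) (𝟙-yes (coprime? 1 n) (1-coprimeTo n)) ⟩
    1 + c                        ∎

φ[n]∣φ[p*n] : Prime p → ∀ n → φ n ∣ φ (p * n)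
φ[n]∣φ[p*n] {p} pp n with p ∣? n
... | yes p∣n = subst (φ n ∣_) (sym (φ[p*n]≡p*φ[n] pp p∣n)) (n∣m*n p)
... | no  p∤n = subst (φ n ∣_) (sym (φ[p*n]≡[p∸1]*φ[n] pp p∤n)) (n∣m*n (p ∸ 1))

prime-factorisation-elim : (Q : Pred ℕ ℓ) → (∀ {ps} → All Prime ps → Q (product ps)) →
                           ∀ n .{{_ : NonZero n}} → Q n
prime-factorisation-elim Q step n = subst Q (sym isFactorisation) (step factorsPrime)
  where open PrimeFactorisation (factorise n)

φ[n]∣φ[n*a] : ∀ n a → φ n ∣ φ (n * a)
φ[n]∣φ[n*a] n zero        = subst (λ m → φ n ∣ φ m) (sym (*-zeroʳ n)) (φ n ∣0)
φ[n]∣φ[n*a] n a@(suc _) = prime-factorisation-elim (λ a → φ n ∣ φ (n * a)) φ[n]∣φ[n*∏ps] a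
  where
  φ[n]∣φ[n*∏ps] : ∀ {ps} → All Prime ps → φ n ∣ φ (n * product ps)
  φ[n]∣φ[n*∏ps] []                 = subst (λ m → φ n ∣ φ m) (sym (*-identityʳ n)) ∣-refl
  φ[n]∣φ[n*∏ps] {p ∷ ps} (pp ∷ pps) = subst (λ m → φ n ∣ φ m) (x∙yz≈y∙xz p n (product ps))
    (∣-trans (φ[n]∣φ[n*∏ps] pps) (φ[n]∣φ[p*n] pp (n * product ps)))

φ[p*m]*x≡φ[p*n]*y : Prime p → (p ∣ m ⇔ p ∣ n) → ∀ x y →
                    φ m * x ≡ φ n * y → φ (p * m) * x ≡ φ (p * n) * y
φ[p*m]*x≡φ[p*n]*y {p} {m} {n} pp p∣m⇔p∣n x y eq = by-cases (p ∣? m)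
  where
  open Equivalence p∣m⇔p∣n
  scale : ∀ c → φ (p * m) ≡ c * φ m → φ (p * n) ≡ c * φ n → φ (p * m) * x ≡ φ (p * n) * y
  scale c φ[p*m]≡c*φ[m] φ[p*n]≡c*φ[n] = begin
    φ (p * m) * x ≡⟨ cong (_* x) φ[p*m]≡c*φ[m] ⟩
    c * φ m * x   ≡⟨ *-assoc c (φ m) x ⟩
    c * (φ m * x) ≡⟨ cong (c *_) eq ⟩
    c * (φ n * y) ≡⟨ *-assoc c (φ n) y ⟨
    c * φ n * y   ≡⟨ cong (_* y) φ[p*n]≡c*φ[n] ⟨
    φ (p * n) * y ∎
  by-cases : Dec (p ∣ m) → φ (p * m) * x ≡ φ (p * n) * y
  by-cases (yes p∣m) = scale p (φ[p*n]≡p*φ[n] pp p∣m) (φ[p*n]≡p*φ[n] pp (to p∣m))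
  by-cases (no  p∤m) = scale (p ∸ 1) (φ[p*n]≡[p∸1]*φ[n] pp p∤m) (φ[p*n]≡[p∸1]*φ[n] pp (p∤m ∘ from))

φ[f*a*b]*φ[f]≡φ[f*a]*φ[f*b] : ∀ f {a b} .{{_ : NonZero a}} → Coprime a b →
                              φ (f * a * b) * φ f ≡ φ (f * a) * φ (f * b)
φ[f*a*b]*φ[f]≡φ[f*a]*φ[f*b] f {a} {b} = prime-factorisation-elim
  (λ a → Coprime a b → φ (f * a * b) * φ f ≡ φ (f * a) * φ (f * b)) (λ pps → along pps) a
  where
  along : ∀ {ps} → All Prime ps → Coprime (product ps) b →
          φ (f * product ps * b) * φ f ≡ φ (f * product ps) * φ (f * b)
  along [] _ rewrite *-identityʳ f = *-comm (φ (f * b)) (φ f)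
  along {p ∷ ps} (pp ∷ pps) c = begin
    φ (f * (p * a′) * b) * φ f   ≡⟨ cong (λ m → φ (m * b) * φ f) (x∙yz≈y∙xz f p a′) ⟩
    φ (p * (f * a′) * b) * φ f   ≡⟨ cong (λ m → φ m * φ f) (*-assoc p (f * a′) b) ⟩
    φ (p * (f * a′ * b)) * φ f
      ≡⟨ φ[p*m]*x≡φ[p*n]*y pp p∣⇔ (φ f) (φ (f * b)) (along pps (coprime-∣ˡ c (n∣m*n p))) ⟩
    φ (p * (f * a′)) * φ (f * b) ≡⟨ cong (λ m → φ m * φ (f * b)) (x∙yz≈y∙xz f p a′) ⟨
    φ (f * (p * a′)) * φ (f * b) ∎
    where
    a′ : ℕ
    a′ = product ps
    p∤b : ¬ p ∣ b
    p∤b = coprime⇒prime∤ pp (coprime-∣ˡ c (m∣m*n a′))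
    p∣⇔ : p ∣ f * a′ * b ⇔ p ∣ f * a′
    p∣⇔ = mk⇔ (λ p∣ → [ id , (λ p∣b → contradiction p∣b p∤b) ]′ (euclidsLemma (f * a′) b pp p∣))
              (∣m⇒∣m*n b)

coprime⇒lcm≡* : Coprime m n → lcm m n ≡ m * n
coprime⇒lcm≡* {m} {n} c = begin
  lcm m n           ≡⟨ *-identityˡ (lcm m n) ⟨
  1 * lcm m n       ≡⟨ cong (_* lcm m n) (coprime⇒gcd≡1 c) ⟨
  gcd m n * lcm m n ≡⟨ gcd*lcm m n ⟩
  m * n             ∎

coprime-*-∣ : Coprime m n → m ∣ o → n ∣ o → m * n ∣ o
coprime-*-∣ {o = o} c m∣o n∣o = subst (_∣ o) (coprime⇒lcm≡* c) (lcm-least m∣o n∣o)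

m∣n⇒gcd[m,n]≡m : m ∣ n → gcd m n ≡ m
m∣n⇒gcd[m,n]≡m {m} {n} m∣n = ∣-antisym (gcd[m,n]∣m m n) (gcd-greatest ∣-refl m∣n)

m∣n⇒lcm[m,n]≡n : m ∣ n → lcm m n ≡ n
m∣n⇒lcm[m,n]≡n {m} {n} m∣n = ∣-antisym (lcm-least m∣n ∣-refl) (n∣lcm[m,n] m n)

gcd[m*n,o]≡gcd[m,o]*gcd[n,o] : Coprime m n → gcd (m * n) o ≡ gcd m o * gcd n o
gcd[m*n,o]≡gcd[m,o]*gcd[n,o] {m} {n} {o} c = ∣-antisym g∣gₘ*gₙ gₘ*gₙ∣g
  where
  g gₘ gₙ : ℕ
  g  = gcd (m * n) o
  gₘ = gcd m o
  gₙ = gcd n o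
  gₘ*gₙ∣g : gₘ * gₙ ∣ g
  gₘ*gₙ∣g = gcd-greatest (*-pres-∣ (gcd[m,n]∣m m o) (gcd[m,n]∣m n o))
    (coprime-*-∣ (coprime-∣ˡ (coprime-∣ʳ c (gcd[m,n]∣m n o)) (gcd[m,n]∣m m o))
                 (gcd[m,n]∣n m o) (gcd[m,n]∣n n o))
  g∣m*gₙ : g ∣ m * gₙ
  g∣m*gₙ = subst (g ∣_) (sym (c*gcd[m,n]≡gcd[cm,cn] m n o))
    (gcd-greatest (gcd[m,n]∣m (m * n) o) (∣n⇒∣m*n m (gcd[m,n]∣n (m * n) o)))
  g∣gₘ*gₙ : g ∣ gₘ * gₙ
  g∣gₘ*gₙ = subst (g ∣_) (trans (sym (c*gcd[m,n]≡gcd[cm,cn] gₙ m o)) (*-comm gₙ gₘ))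
    (gcd-greatest (subst (g ∣_) (*-comm m gₙ) g∣m*gₙ) (∣n⇒∣m*n gₙ (gcd[m,n]∣n (m * n) o)))

m≡q*gcd[m,n]⇒lcm[m,n]≡n*q : ∀ {m n q} .{{_ : NonZero n}} → m ≡ q * gcd m n → lcm m n ≡ n * q
m≡q*gcd[m,n]⇒lcm[m,n]≡n*q {m} {n} {q} m≡q*g =
  *-cancelˡ-≡ (lcm m n) (n * q) (gcd m n) {{gcd≢0}} (begin
  gcd m n * lcm m n ≡⟨ gcd*lcm m n ⟩
  m * n             ≡⟨ cong (_* n) m≡q*g ⟩
  q * gcd m n * n   ≡⟨ xy∙z≈y∙zx q (gcd m n) n ⟩
  gcd m n * (n * q) ∎)
  where
  gcd≢0 : NonZero (gcd m n)
  gcd≢0 = ≢-nonZero (gcd[m,n]≢0 m n (inj₂ (≢-nonZero⁻¹ n)))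

lcm[m,n]≡n*quotient : ∀ m n .{{_ : NonZero n}} → lcm m n ≡ n * quotient (gcd[m,n]∣m m n)
lcm[m,n]≡n*quotient m n = m≡q*gcd[m,n]⇒lcm[m,n]≡n*q (m∣n⇒n≡quotient*m (gcd[m,n]∣m m n))

φ[n]∣φ[lcm[m,n]] : ∀ m n .{{_ : NonZero n}} → φ n ∣ φ (lcm m n)
φ[n]∣φ[lcm[m,n]] m n = subst (λ l → φ n ∣ φ l) (sym (lcm[m,n]≡n*quotient m n)) (φ[n]∣φ[n*a] n _)

φ[lcm[p,n]]≡[p∸1]*φ[n] : Prime p → ¬ p ∣ n → φ (lcm p n) ≡ (p ∸ 1) * φ n
φ[lcm[p,n]]≡[p∸1]*φ[n] pp p∤n =
  trans (cong φ (coprime⇒lcm≡* (prime∤⇒coprime pp p∤n))) (φ[p*n]≡[p∸1]*φ[n] pp p∤n)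

φ[lcm[m*n,o]]*φ[o]≡φ[lcm[m,o]]*φ[lcm[n,o]] : ∀ {m n o} .{{_ : NonZero m}} .{{_ : NonZero o}} →
  Coprime m n → φ (lcm (m * n) o) * φ o ≡ φ (lcm m o) * φ (lcm n o)
φ[lcm[m*n,o]]*φ[o]≡φ[lcm[m,o]]*φ[lcm[n,o]] {m} {n} {o} c = begin
  φ (lcm (m * n) o) * φ o      ≡⟨ cong (λ l → φ l * φ o) lcm[m*n,o]≡o*aₘ*aₙ ⟩
  φ (o * aₘ * aₙ) * φ o        ≡⟨ φ[f*a*b]*φ[f]≡φ[f*a]*φ[f*b] o aₘ⊥aₙ ⟩
  φ (o * aₘ) * φ (o * aₙ)
    ≡⟨ cong₂ (λ k l → φ k * φ l) (lcm[m,n]≡n*quotient m o) (lcm[m,n]≡n*quotient n o) ⟨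
  φ (lcm m o) * φ (lcm n o)    ∎
  where
  gₘ∣m : gcd m o ∣ m
  gₘ∣m = gcd[m,n]∣m m o
  gₙ∣n : gcd n o ∣ n
  gₙ∣n = gcd[m,n]∣m n o
  aₘ aₙ : ℕ
  aₘ = quotient gₘ∣m
  aₙ = quotient gₙ∣n
  instance
    aₘ≢0 : NonZero aₘ
    aₘ≢0 = quotient≢0 gₘ∣m
  aₘ⊥aₙ : Coprime aₘ aₙ
  aₘ⊥aₙ = coprime-∣ˡ (coprime-∣ʳ c (quotient-∣ gₙ∣n)) (quotient-∣ gₘ∣m)
  m*n≡aₘ*aₙ*gcd[m*n,o] : m * n ≡ aₘ * aₙ * gcd (m * n) o
  m*n≡aₘ*aₙ*gcd[m*n,o] = begin
    m * n                          ≡⟨ cong₂ _*_ (m∣n⇒n≡quotient*m gₘ∣m) (m∣n⇒n≡quotient*m gₙ∣n) ⟩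
    aₘ * gcd m o * (aₙ * gcd n o)  ≡⟨ *-interchange aₘ (gcd m o) aₙ (gcd n o) ⟩
    aₘ * aₙ * (gcd m o * gcd n o)  ≡⟨ cong (aₘ * aₙ *_) (gcd[m*n,o]≡gcd[m,o]*gcd[n,o] c) ⟨
    aₘ * aₙ * gcd (m * n) o        ∎
  lcm[m*n,o]≡o*aₘ*aₙ : lcm (m * n) o ≡ o * aₘ * aₙ
  lcm[m*n,o]≡o*aₘ*aₙ =
    trans (m≡q*gcd[m,n]⇒lcm[m,n]≡n*q m*n≡aₘ*aₙ*gcd[m*n,o]) (sym (*-assoc o aₘ aₙ))

module Weight (f h : ℕ) .{{_ : NonZero f}} .{{_ : NonZero h}} where

  instance
    φ[f]≢0 : NonZero (φ f)
    φ[f]≢0 = φ[n]≢0 f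

  wDen≢0 : ∀ k → NonZero (wDen f h k)
  wDen≢0 k = m*n≢0 (gcd k h) (φ f) {{gcd≢0}}
    where
    gcd≢0 : NonZero (gcd k h)
    gcd≢0 = ≢-nonZero (gcd[m,n]≢0 k h (inj₂ (≢-nonZero⁻¹ h)))

  wDen∣wNum : ∀ k → wDen f h k ∣ wNum f k
  wDen∣wNum k = *-pres-∣ (gcd[m,n]∣m k h) (φ[n]∣φ[lcm[m,n]] k f)

  w : ℕ → ℕ
  w k = quotient (wDen∣wNum k)

  w*wDen≡wNum : ∀ k → w k * wDen f h k ≡ wNum f k
  w*wDen≡wNum k = sym (m∣n⇒n≡quotient*m (wDen∣wNum k))

  w-unique : ∀ k {x} → x * wDen f h k ≡ wNum f k → w k ≡ x
  w-unique k {x} eq =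
    *-cancelʳ-≡ (w k) x (wDen f h k) {{wDen≢0 k}} (trans (w*wDen≡wNum k) (sym eq))

  w[1]≡1 : w 1 ≡ 1
  w[1]≡1 = w-unique 1 (cong (1 *_) (begin
    gcd 1 h * φ f ≡⟨ cong (_* φ f) (gcd-zeroˡ h) ⟩
    1 * φ f       ≡⟨ *-identityˡ (φ f) ⟩
    φ f           ≡⟨ cong φ (m∣n⇒lcm[m,n]≡n (1∣ f)) ⟨
    φ (lcm 1 f)   ∎))

  wNum-* : ∀ {m n} .{{_ : NonZero m}} → Coprime m n → wNum f (m * n) * φ f ≡ wNum f m * wNum f n
  wNum-* {m} {n} c = begin
    m * n * φ (lcm (m * n) f) * φ f
      ≡⟨ *-assoc (m * n) _ (φ f) ⟩
    m * n * (φ (lcm (m * n) f) * φ f)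
      ≡⟨ cong (m * n *_) (φ[lcm[m*n,o]]*φ[o]≡φ[lcm[m,o]]*φ[lcm[n,o]] c) ⟩
    m * n * (φ (lcm m f) * φ (lcm n f))
      ≡⟨ *-interchange m (φ (lcm m f)) n (φ (lcm n f)) ⟨
    m * φ (lcm m f) * (n * φ (lcm n f)) ∎

  wDen-* : ∀ {m n} → Coprime m n → wDen f h (m * n) * φ f ≡ wDen f h m * wDen f h n
  wDen-* {m} {n} c = begin
    gcd (m * n) h * φ f * φ f          ≡⟨ *-assoc (gcd (m * n) h) (φ f) (φ f) ⟩
    gcd (m * n) h * (φ f * φ f)        ≡⟨ cong (_* (φ f * φ f)) (gcd[m*n,o]≡gcd[m,o]*gcd[n,o] c) ⟩
    gcd m h * gcd n h * (φ f * φ f)    ≡⟨ *-interchange (gcd m h) (φ f) (gcd n h) (φ f) ⟨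
    gcd m h * φ f * (gcd n h * φ f)    ∎

  w-* : ∀ {m n} .{{_ : NonZero m}} → Coprime m n → w (m * n) ≡ w m * w n
  w-* {m} {n} c = w-unique (m * n) (*-cancelʳ-≡ _ _ (φ f) (begin
    w m * w n * wDen f h (m * n) * φ f              ≡⟨ *-assoc (w m * w n) _ (φ f) ⟩
    w m * w n * (wDen f h (m * n) * φ f)            ≡⟨ cong (w m * w n *_) (wDen-* c) ⟩
    w m * w n * (wDen f h m * wDen f h n)
      ≡⟨ *-interchange (w m) (wDen f h m) (w n) (wDen f h n) ⟨
    w m * wDen f h m * (w n * wDen f h n)           ≡⟨ cong₂ _*_ (w*wDen≡wNum m) (w*wDen≡wNum n) ⟩
    wNum f m * wNum f n                             ≡⟨ wNum-* c ⟨
    wNum f (m * n) * φ f                            ∎))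

  w[p]≡p*e : ∀ {p e} → Prime p → ¬ p ∣ h → φ (lcm p f) ≡ e * φ f → w p ≡ p * e
  w[p]≡p*e {p} {e} pp p∤h φ[lcm[p,f]]≡e*φ[f] = w-unique p (begin
    p * e * (gcd p h * φ f)
      ≡⟨ cong (λ g → p * e * (g * φ f)) (coprime⇒gcd≡1 (prime∤⇒coprime pp p∤h)) ⟩
    p * e * (1 * φ f)         ≡⟨ cong (p * e *_) (*-identityˡ (φ f)) ⟩
    p * e * φ f               ≡⟨ *-assoc p e (φ f) ⟩
    p * (e * φ f)             ≡⟨ cong (p *_) φ[lcm[p,f]]≡e*φ[f] ⟨
    p * φ (lcm p f)           ∎)

  w[p]≡e : ∀ {p e} → p ∣ h → φ (lcm p f) ≡ e * φ f → w p ≡ e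
  w[p]≡e {p} {e} p∣h φ[lcm[p,f]]≡e*φ[f] = w-unique p (begin
    e * (gcd p h * φ f)       ≡⟨ cong (λ g → e * (g * φ f)) (m∣n⇒gcd[m,n]≡m p∣h) ⟩
    e * (p * φ f)             ≡⟨ x∙yz≈y∙xz e p (φ f) ⟩
    p * (e * φ f)             ≡⟨ cong (p *_) φ[lcm[p,f]]≡e*φ[f] ⟨
    p * φ (lcm p f)           ∎)

proposition1 : (f h : ℕ) → 1 ≤ f → 1 ≤ h →
    Σ (ℕ → ℕ) λ w →
      ((k : ℕ) → 1 ≤ k → w k * wDen f h k ≡ wNum f k)
      × (w 1 ≡ 1)
      × ((m n : ℕ) → 1 ≤ m → 1 ≤ n → Coprime m n → w (m * n) ≡ w m * w n)
      × ((p : ℕ) → Prime p → ¬ (p ∣ h) → ¬ (p ∣ f) → w p ≡ p * (p ∸ 1))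
      × ((p : ℕ) → Prime p → ¬ (p ∣ h) → p ∣ f → w p ≡ p)
      × ((p : ℕ) → Prime p → p ∣ h → ¬ (p ∣ f) → w p ≡ p ∸ 1)
      × ((p : ℕ) → Prime p → p ∣ h → p ∣ f → w p ≡ 1)
      × (¬ (2 ∣ h) → w 2 ≡ 2)
proposition1 f h 1≤f 1≤h =
  w , (λ k _ → w*wDen≡wNum k) , w[1]≡1 , (λ m n 1≤m _ → w-* {{>-nonZero 1≤m}})
    , case-i , case-ii , case-iii , case-iv , case-v
  where
  open Weight f h {{>-nonZero 1≤f}} {{>-nonZero 1≤h}}

  φ[lcm[p,f]]≡1*φ[f] : ∀ {p} → p ∣ f → φ (lcm p f) ≡ 1 * φ f
  φ[lcm[p,f]]≡1*φ[f] p∣f = trans (cong φ (m∣n⇒lcm[m,n]≡n p∣f)) (sym (*-identityˡ (φ f)))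

  case-i : ∀ p → Prime p → ¬ p ∣ h → ¬ p ∣ f → w p ≡ p * (p ∸ 1)
  case-i p pp p∤h p∤f = w[p]≡p*e pp p∤h (φ[lcm[p,n]]≡[p∸1]*φ[n] pp p∤f)

  case-ii : ∀ p → Prime p → ¬ p ∣ h → p ∣ f → w p ≡ p
  case-ii p pp p∤h p∣f = trans (w[p]≡p*e pp p∤h (φ[lcm[p,f]]≡1*φ[f] p∣f)) (*-identityʳ p)

  case-iii : ∀ p → Prime p → p ∣ h → ¬ p ∣ f → w p ≡ p ∸ 1
  case-iii p pp p∣h p∤f = w[p]≡e p∣h (φ[lcm[p,n]]≡[p∸1]*φ[n] pp p∤f)

  case-iv : ∀ p → Prime p → p ∣ h → p ∣ f → w p ≡ 1
  case-iv p _ p∣h p∣f = w[p]≡e p∣h (φ[lcm[p,f]]≡1*φ[f] p∣f)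

  case-v : ¬ 2 ∣ h → w 2 ≡ 2
  case-v 2∤h with 2 ∣? f
  ... | yes 2∣f = case-ii 2 prime[2] 2∤h 2∣f
  ... | no  2∤f = case-i 2 prime[2] 2∤h 2∤f
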